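{- For integers $n>d\geq k\geq 2$, let $\theta(n,d,k)$ be the smallest integer $\theta$ such that every $n$-vertex graph with at least $\theta$ vertices of degree at least $d$ contains a cycle on at least $k+1$ vertices. Then for every integer $k\geq 2$ there exist infinitely many integers $d$ such that the following holds: there is a constant $c=c(d,k)>0$ such that $\theta(n,d,k)>\left(\lfloor\frac{k}{2}\rfloor+c\right)\cdot\frac{n-1}{d}$ for infinitely many integers $n$.
   Context: All graphs are finite and simple. -}

module Defs where

open import Data.Nat using (ℕ; zero; suc; _≤_; _<_; _≤ᵇ_; _∸_; _/_)
open import Data.Bool using (Bool; true; false)
open import Data.Fin using (Fin; inject₁; fromℕ)
import Data.Fin as F
open import Data.List using (List; length; filterᵇ; allFin)
open import Data.Product using (Σ; ∃; _×_; _,_)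
open import Function.Definitions using (Injective)
open import Relation.Binary.PropositionalEquality using (_≡_)
open import Data.Integer using (+_)
open import Data.Empty using (⊥)
import Data.Rational as ℚ
open ℚ using (ℚ)

record Graph (n : ℕ) : Set where
  field
    adj   : Fin n → Fin n → Bool
    sym   : ∀ i j → adj i j ≡ adj j i
    irrefl : ∀ i → adj i i ≡ false
open Graph public

degree : ∀ {n} → Graph n → Fin n → ℕ
degree {n} G i = length (filterᵇ (adj G i) (allFin n))

numHighDeg : ∀ {n} → Graph n → ℕ → ℕ
numHighDeg {n} G d = length (filterᵇ (λ i → d ≤ᵇ degree G i) (allFin n))

CycleOfLength : ∀ {n} → Graph n → ℕ → Set
CycleOfLength {n} G zero = ⊥
CycleOfLength {n} G (suc p) =
  2 ≤ p × Σ (Fin (suc p) → Fin n) λ f →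
    Injective _≡_ _≡_ f
    × (∀ (i : Fin p) → adj G (f (inject₁ i)) (f (F.suc i)) ≡ true)
    × adj G (f (fromℕ p)) (f F.zero) ≡ true

HasCycleAtLeast : ∀ {n} → Graph n → ℕ → Set
HasCycleAtLeast G m = ∃ λ ℓ → m ≤ ℓ × CycleOfLength G ℓ

ThetaProp : ℕ → ℕ → ℕ → ℕ → Set
ThetaProp n d k θ = (G : Graph n) → θ ≤ numHighDeg G d → HasCycleAtLeast G (suc k)

IsTheta : ℕ → ℕ → ℕ → ℕ → Set
IsTheta n d k θ = ThetaProp n d k θ × (∀ θ' → ThetaProp n d k θ' → θ ≤ θ')

-- the rational number a / d (d > 0 in all uses; value 0 for d = 0)
ratio : ℕ → ℕ → ℚ
ratio a zero = ℚ.0ℚ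
ratio a (suc d) = + a ℚ./ suc d

natℚ : ℕ → ℚ
natℚ a = + a ℚ./ 1

{-# OPTIONS --safe #-}
-- Take t disjoint copies of the following graph: a centre joined to the hubs of r ≥ 2 blocks, each
-- block being a clique on s hubs together with (r - 1) s leaves joined to every hub of the block.
-- With d = r s, the centre and the hubs all have degree d, so t (1 + d) of the n = t (1 + r d)
-- vertices have degree at least d. A cycle lies in one copy and, apart from the centre, in one
-- block, so it contains at most s hubs; as the centre and the leaves are adjacent only to hubs,
-- the cycle has at most 2 s ≤ k vertices for s = ⌊k/2⌋. Hence θ(n, d, k) > t (1 + d), which exceeds
-- (s + 1/(1 + r d)) (n - 1)/d because s + 1 ≤ d.
module Submission where

open import Data.Bool using (Bool; T; true)
open import Data.Bool.Properties using (T-≡)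
open import Data.Empty using (⊥-elim)
open import Data.Fin as Fin using (Fin; zero; suc; toℕ; inject₁; fromℕ; lower₁; splitAt; join; remQuot)
open import Data.Fin.Induction using (<-weakInduction; >-weakInduction)
open import Data.Fin.Properties
  using (_≟_; toℕ-injective; toℕ-fromℕ; inject₁-lower₁; lower₁-injective; suc-injective; 0≢1+n;
         <-cmp; <⇒≢; ≤fromℕ; ℕ<⇒inject₁<; ≤̄⇒inject₁<; any?; injective⇒≤; *↔×; +↔⊎; 1↔⊤)
open import Data.Integer as ℤ using (+_; +<+)
import Data.Integer.Properties as ℤ
open import Data.List using (List; length; filterᵇ; allFin; lookup)
open import Data.List.Membership.Propositional using (_∈_)
open import Data.List.Membership.Propositional.Properties using (∈-filter⁺; ∈-allFin)
open import Data.List.Relation.Unary.Any using (index)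
open import Data.List.Relation.Unary.Any.Properties using (lookup-index)
open import Data.Maybe using (Maybe; just; nothing)
open import Data.Maybe.Properties using (just-injective)
open import Data.Nat as ℕ using (ℕ; _≤_; _<_; _/_; _∸_)
open import Data.Nat.DivMod using (m≥n⇒m/n>0; m/n*n≤m)
import Data.Nat.Properties as ℕ
open import Data.Nat.Tactic.RingSolver using (solve-∀)
open import Data.Product using (_×_; _,_; proj₁; proj₂; ∃; map₂)
open import Data.Product.Function.NonDependent.Propositional using (_×-↔_)
open import Data.Product.Properties using (,-injectiveˡ; ,-injectiveʳ)
open import Data.Rational as ℚ using (ℚ; 0ℚ; toℚᵘ; _+_; _*_)
open import Data.Rational.Properties using (toℚᵘ-cancel-<; toℚᵘ-homo-+; toℚᵘ-homo-*; toℚᵘ-fromℚᵘ)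
open import Data.Rational.Unnormalised as ℚᵘ using (ℚᵘ; mkℚᵘ)
import Data.Rational.Unnormalised.Properties as ℚᵘ
open import Data.Sum using (_⊎_; inj₁; inj₂)
open import Data.Sum.Function.Propositional using (_⊎-↔_)
open import Data.Sum.Properties using (inj₁-injective; inj₂-injective)
open import Data.Unit using (⊤; tt)
open import Function using (_∘_)
open import Function.Bundles using (_↔_; Inverse; Injection; Equivalence; mk⇔)
open import Function.Definitions using (Injective)
open import Function.Properties.Inverse using (↔⇒↣; ↔-sym; ↔-refl; ↔-trans)
open import Relation.Binary.Definitions using (Decidable; Symmetric; tri<; tri≈; tri>)
open import Relation.Binary.PropositionalEquality
open import Relation.Nullary using (Dec; yes; no; ¬_; does; _×-dec_)
open import Relation.Nullary.Decidable using (T?; does-⇔; dec-true; dec-false)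

open import Defs hiding (sym)

≤-length-filterᵇ : ∀ {m n} (P : Fin n → Bool) (g : Fin m → Fin n) →
  Injective _≡_ _≡_ g → (∀ i → T (P (g i))) → m ≤ length (filterᵇ P (allFin n))
≤-length-filterᵇ {m} {n} P g g-injective Pg = injective⇒≤ position-injective
  where
  xs : List (Fin n)
  xs = filterᵇ P (allFin n)

  member : ∀ i → g i ∈ xs
  member i = ∈-filter⁺ (T? ∘ P) (∈-allFin (g i)) (Pg i)

  position-injective : Injective _≡_ _≡_ (index ∘ member)
  position-injective {i} {j} e = g-injective (begin
    g i                          ≡⟨ lookup-index (member i) ⟩
    lookup xs (index (member i)) ≡⟨ cong (lookup xs) e ⟩
    lookup xs (index (member j)) ≡⟨ lookup-index (member j) ⟨
    g j                          ∎)
    where open ≡-Reasoning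

↔-to-injective : ∀ {A B : Set} (ι : A ↔ B) → Injective _≡_ _≡_ (Inverse.to ι)
↔-to-injective ι = Injection.injective (↔⇒↣ ι)

↔-from-injective : ∀ {A B : Set} (ι : A ↔ B) → Injective _≡_ _≡_ (Inverse.from ι)
↔-from-injective ι = ↔-to-injective (↔-sym ι)

module _ {B : Set} {p : ℕ} (b : Fin (ℕ.suc p) → B) where

  steps-preserve⇒constant : (∀ i → b (inject₁ i) ≡ b (suc i)) → ∀ x → b x ≡ b zero
  steps-preserve⇒constant step =
    <-weakInduction (λ x → b x ≡ b zero) refl (λ i bi≡b0 → trans (sym (step i)) bi≡b0)

  -- Removing position q from the cyclic order 0, 1, …, p, 0 leaves a path, along which b is constant.
  steps-preserve-except⇒constant : (q : Fin (ℕ.suc p)) →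
    (∀ i → inject₁ i ≢ q → suc i ≢ q → b (inject₁ i) ≡ b (suc i)) →
    (fromℕ p ≢ q → zero ≢ q → b (fromℕ p) ≡ b zero) →
    ∀ {x y} → x ≢ q → y ≢ q → b x ≡ b y
  steps-preserve-except⇒constant q step close = constant
    where
    before : ∀ x → x Fin.< q → b x ≡ b zero
    before = <-weakInduction (λ x → x Fin.< q → b x ≡ b zero) (λ _ → refl) λ i ih si<q →
      let i<q = ℕ<⇒inject₁< (ℕ.<-trans (ℕ.n<1+n (toℕ i)) si<q)
      in trans (sym (step i (<⇒≢ i<q) (<⇒≢ si<q))) (ih i<q)

    after : ∀ x → q Fin.< x → b x ≡ b (fromℕ p)
    after = >-weakInduction (λ x → q Fin.< x → b x ≡ b (fromℕ p)) (λ _ → refl) λ i ih q<i →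
      let q<si = ℕ.<-trans q<i (≤̄⇒inject₁< ℕ.≤-refl)
      in trans (step i (≢-sym (<⇒≢ q<i)) (≢-sym (<⇒≢ q<si))) (ih q<si)

    bridge : ∀ {x y} → x Fin.< q → q Fin.< y → b x ≡ b y
    bridge {x} {y} x<q q<y = begin
      b x         ≡⟨ before x x<q ⟩
      b zero      ≡⟨ close last≢q 0≢q ⟨
      b (fromℕ p) ≡⟨ after y q<y ⟨
      b y         ∎
      where
      open ≡-Reasoning
      last≢q : fromℕ p ≢ q
      last≢q = ≢-sym (<⇒≢ (ℕ.<-≤-trans q<y (≤fromℕ y)))
      0≢q : zero ≢ q
      0≢q = <⇒≢ (ℕ.≤-<-trans ℕ.z≤n x<q)

    constant : ∀ {x y} → x ≢ q → y ≢ q → b x ≡ b y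
    constant {x} {y} x≢q y≢q with <-cmp x q | <-cmp y q
    ... | tri≈ _ x≡q _ | _            = ⊥-elim (x≢q x≡q)
    ... | _            | tri≈ _ y≡q _ = ⊥-elim (y≢q y≡q)
    ... | tri< x<q _ _ | tri< y<q _ _ = trans (before x x<q) (sym (before y y<q))
    ... | tri> _ _ q<x | tri> _ _ q<y = trans (after x q<x) (sym (after y q<y))
    ... | tri< x<q _ _ | tri> _ _ q<y = bridge x<q q<y
    ... | tri> _ _ q<x | tri< y<q _ _ = sym (bridge y<q q<x)

record Cycle {V : Set} (_~_ : V → V → Set) (p : ℕ) : Set where
  field
    vertex    : Fin (ℕ.suc p) → V
    injective : Injective _≡_ _≡_ vertex
    step      : ∀ i → vertex (inject₁ i) ~ vertex (suc i)
    close     : vertex (fromℕ p) ~ vertex zero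

  next : Fin (ℕ.suc p) → Fin (ℕ.suc p)
  next x with p ℕ.≟ toℕ x
  ... | yes _   = zero
  ... | no p≢x = suc (lower₁ x p≢x)

  next-injective : Injective _≡_ _≡_ next
  next-injective {x} {y} e with p ℕ.≟ toℕ x | p ℕ.≟ toℕ y
  ... | yes p≡x | yes p≡y = toℕ-injective (trans (sym p≡x) p≡y)
  ... | yes _   | no _    = ⊥-elim (0≢1+n e)
  ... | no _    | yes _   = ⊥-elim (0≢1+n (sym e))
  ... | no _    | no _    = lower₁-injective (suc-injective e)

  step-next : ∀ x → vertex x ~ vertex (next x)
  step-next x with p ℕ.≟ toℕ x
  ... | yes p≡x = subst (λ y → vertex y ~ vertex zero) (toℕ-injective (trans (toℕ-fromℕ p) p≡x)) close
  ... | no p≢x = subst (λ y → vertex y ~ vertex (suc (lower₁ x p≢x))) (inject₁-lower₁ x p≢x) (step (lower₁ x p≢x))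

module GraphOn {V : Set} {N : ℕ} (ι : Fin N ↔ V) {_~_ : V → V → Set} (_~?_ : Decidable _~_)
               (~-sym : Symmetric _~_) (~-irrefl : ∀ {v} → ¬ v ~ v) where

  open Inverse ι using (to; from; strictlyInverseˡ)

  graph : Graph N
  graph = record
    { adj    = λ i j → does (to i ~? to j)
    ; sym    = λ i j → does-⇔ (mk⇔ ~-sym ~-sym) (to i ~? to j) (to j ~? to i)
    ; irrefl = λ i → dec-false (to i ~? to i) ~-irrefl
    }

  adj⇒~ : ∀ {i j} → adj graph i j ≡ true → to i ~ to j
  adj⇒~ {i} {j} e with to i ~? to j
  ... | yes i~j = i~j

  ~⇒adj : ∀ {u v} → u ~ v → T (adj graph (from u) (from v))
  ~⇒adj {u} {v} u~v = Equivalence.from T-≡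
    (dec-true (to (from u) ~? to (from v)) (subst₂ _~_ (sym (strictlyInverseˡ u)) (sym (strictlyInverseˡ v)) u~v))

  ≤-degree : ∀ {m} v (w : Fin m → V) → Injective _≡_ _≡_ w → (∀ j → v ~ w j) → m ≤ degree graph (from v)
  ≤-degree v w w-injective v~w =
    ≤-length-filterᵇ _ (from ∘ w) (w-injective ∘ ↔-from-injective ι) (~⇒adj ∘ v~w)

  ≤-numHighDeg : ∀ {m} d (w : Fin m → V) → Injective _≡_ _≡_ w → (∀ j → d ≤ degree graph (from (w j))) →
    m ≤ numHighDeg graph d
  ≤-numHighDeg d w w-injective high =
    ≤-length-filterᵇ _ (from ∘ w) (w-injective ∘ ↔-from-injective ι) (ℕ.≤⇒≤ᵇ ∘ high)

  cycle : ∀ {p} → CycleOfLength graph (ℕ.suc p) → Cycle _~_ p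
  cycle (_ , f , f-injective , step , close) = record
    { vertex    = to ∘ f
    ; injective = f-injective ∘ ↔-to-injective ι
    ; step      = adj⇒~ ∘ step
    ; close     = adj⇒~ close
    }

  cycles-bounded⇒no-long-cycle : ∀ {L} → (∀ {p} → Cycle _~_ p → ℕ.suc p ≤ L) →
    ∀ {k} → L ≤ k → ¬ HasCycleAtLeast graph (ℕ.suc k)
  cycles-bounded⇒no-long-cycle bounded L≤k (ℕ.suc p , 1+k≤1+p , C) =
    ℕ.n≮n _ (ℕ.≤-trans 1+k≤1+p (ℕ.≤-trans (bounded (cycle C)) L≤k))

numHighDeg<θ : ∀ {n d k θ} (G : Graph n) → ¬ HasCycleAtLeast G (ℕ.suc k) → IsTheta n d k θ → numHighDeg G d < θ
numHighDeg<θ G no-cycle (θ-suffices , _) = ℕ.≰⇒> (no-cycle ∘ θ-suffices G)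

Kind : ℕ → ℕ → ℕ → Set
Kind r s m = ⊤ ⊎ (Fin r × Fin s ⊎ Fin r × Fin m)

pattern centre   = inj₁ tt
pattern hub b a  = inj₂ (inj₁ (b , a))
pattern leaf b l = inj₂ (inj₂ (b , l))

module Construction (t r s m : ℕ) where

  data _~ₖ_ : Kind r s m → Kind r s m → Set where
    centre~hub : ∀ {b a}    → centre ~ₖ hub b a
    hub~centre : ∀ {b a}    → hub b a ~ₖ centre
    hub~hub    : ∀ {b a a'} → a ≢ a' → hub b a ~ₖ hub b a'
    hub~leaf   : ∀ {b a l}  → hub b a ~ₖ leaf b l
    leaf~hub   : ∀ {b a l}  → leaf b l ~ₖ hub b a

  _~ₖ?_ : Decidable _~ₖ_
  centre   ~ₖ? centre    = no λ ()
  centre   ~ₖ? hub _ _   = yes centre~hub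
  centre   ~ₖ? leaf _ _  = no λ ()
  hub _ _  ~ₖ? centre    = yes hub~centre
  hub b a  ~ₖ? hub b' a' with b ≟ b' | a ≟ a'
  ... | yes refl | no a≢a'   = yes (hub~hub a≢a')
  ... | yes refl | yes refl  = no λ { (hub~hub a≢a) → a≢a refl }
  ... | no b≢b'  | _         = no λ { (hub~hub _) → b≢b' refl }
  hub b _  ~ₖ? leaf b' _ with b ≟ b'
  ... | yes refl = yes hub~leaf
  ... | no b≢b'  = no λ { hub~leaf → b≢b' refl }
  leaf _ _ ~ₖ? centre    = no λ ()
  leaf b _ ~ₖ? hub b' _ with b ≟ b'
  ... | yes refl = yes leaf~hub
  ... | no b≢b'  = no λ { leaf~hub → b≢b' refl }
  leaf _ _ ~ₖ? leaf _ _  = no λ ()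

  ~ₖ-sym : Symmetric _~ₖ_
  ~ₖ-sym centre~hub      = hub~centre
  ~ₖ-sym hub~centre      = centre~hub
  ~ₖ-sym (hub~hub a≢a')  = hub~hub (≢-sym a≢a')
  ~ₖ-sym hub~leaf        = leaf~hub
  ~ₖ-sym leaf~hub        = hub~leaf

  ~ₖ-irrefl : ∀ {x} → ¬ x ~ₖ x
  ~ₖ-irrefl (hub~hub a≢a) = a≢a refl

  Vertex : Set
  Vertex = Fin t × Kind r s m

  _~_ : Vertex → Vertex → Set
  u ~ v = proj₁ u ≡ proj₁ v × proj₂ u ~ₖ proj₂ v

  _~?_ : Decidable _~_
  u ~? v = proj₁ u ≟ proj₁ v ×-dec proj₂ u ~ₖ? proj₂ v

  vertex-index : Fin (t ℕ.* ℕ.suc (r ℕ.* s ℕ.+ r ℕ.* m)) ↔ Vertex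
  vertex-index = ↔-trans *↔× (↔-refl ×-↔ ↔-trans +↔⊎ (1↔⊤ ⊎-↔ ↔-trans +↔⊎ (*↔× ⊎-↔ *↔×)))

  open GraphOn vertex-index _~?_ (λ (c≡c' , x~y) → sym c≡c' , ~ₖ-sym x~y) (λ (_ , x~x) → ~ₖ-irrefl x~x) public
  open Inverse vertex-index using (from)

  -- The hub's own slot a stands for the centre, so Fin s ⊎ Fin m enumerates its neighbours.
  hub-neighbour : Fin r → Fin s → Fin s ⊎ Fin m → Kind r s m
  hub-neighbour b a (inj₁ a') with a' ≟ a
  ... | yes _ = centre
  ... | no _  = hub b a'
  hub-neighbour b a (inj₂ l) = leaf b l

  hub~hub-neighbour : ∀ b a j → hub b a ~ₖ hub-neighbour b a j
  hub~hub-neighbour b a (inj₁ a') with a' ≟ a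
  ... | yes _   = hub~centre
  ... | no a'≢a = hub~hub (≢-sym a'≢a)
  hub~hub-neighbour b a (inj₂ l) = hub~leaf

  hub-neighbour-injective : ∀ b a → Injective _≡_ _≡_ (hub-neighbour b a)
  hub-neighbour-injective b a {inj₁ x} {inj₁ y} e with x ≟ a | y ≟ a | e
  ... | yes refl | yes refl | _    = refl
  ... | no _     | no _     | refl = refl
  hub-neighbour-injective b a {inj₁ x} {inj₂ _} e with x ≟ a | e
  ... | yes _ | ()
  ... | no _  | ()
  hub-neighbour-injective b a {inj₂ _} {inj₁ y} e with y ≟ a | e
  ... | yes _ | ()
  ... | no _  | ()
  hub-neighbour-injective b a {inj₂ _} {inj₂ _} refl = refl

  hub-degree : ∀ c b a → s ℕ.+ m ≤ degree graph (from (c , hub b a))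
  hub-degree c b a = ≤-degree (c , hub b a) (λ j → c , hub-neighbour b a (splitAt s j))
    (λ e → ↔-to-injective +↔⊎ (hub-neighbour-injective b a (,-injectiveʳ e)))
    (λ j → refl , hub~hub-neighbour b a (splitAt s j))

  centre-neighbour : Fin (r ℕ.* s) → Kind r s m
  centre-neighbour j = inj₂ (inj₁ (remQuot s j))

  centre-neighbour-injective : Injective _≡_ _≡_ centre-neighbour
  centre-neighbour-injective = ↔-to-injective *↔× ∘ inj₁-injective ∘ inj₂-injective

  centre-degree : ∀ c → r ℕ.* s ≤ degree graph (from (c , centre))
  centre-degree c = ≤-degree (c , centre) (λ j → c , centre-neighbour j)
    (centre-neighbour-injective ∘ ,-injectiveʳ) (λ _ → refl , centre~hub)

  high-kind : Fin (ℕ.suc (r ℕ.* s)) → Kind r s m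
  high-kind zero    = centre
  high-kind (suc j) = centre-neighbour j

  high-kind-injective : Injective _≡_ _≡_ high-kind
  high-kind-injective {zero}  {zero}  _ = refl
  high-kind-injective {suc _} {suc _} e = cong suc (centre-neighbour-injective e)

  high-kind-degree : ∀ {d} → d ≤ r ℕ.* s → d ≤ s ℕ.+ m → ∀ c j → d ≤ degree graph (from (c , high-kind j))
  high-kind-degree d≤rs _ c zero = ℕ.≤-trans d≤rs (centre-degree c)
  high-kind-degree _ d≤s+m c (suc j) = ℕ.≤-trans d≤s+m (hub-degree c _ _)

  high-degree-count : ∀ {d} → d ≤ r ℕ.* s → d ≤ s ℕ.+ m → t ℕ.* ℕ.suc (r ℕ.* s) ≤ numHighDeg graph d
  high-degree-count {d} d≤rs d≤s+m = ≤-numHighDeg d (map₂ high-kind ∘ remQuot {t} (ℕ.suc (r ℕ.* s)))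
    (λ e → ↔-to-injective (*↔× {t}) (cong₂ _,_ (,-injectiveˡ e) (high-kind-injective (,-injectiveʳ e))))
    (λ i → high-kind-degree d≤rs d≤s+m _ (proj₂ (remQuot {t} _ i)))

  block : Kind r s m → Maybe (Fin r)
  block centre     = nothing
  block (hub b _)  = just b
  block (leaf b _) = just b

  ~ₖ-block : ∀ {x y} → x ≢ centre → y ≢ centre → x ~ₖ y → block x ≡ block y
  ~ₖ-block x≢centre _ centre~hub = ⊥-elim (x≢centre refl)
  ~ₖ-block _ y≢centre hub~centre = ⊥-elim (y≢centre refl)
  ~ₖ-block _ _ (hub~hub _)       = refl
  ~ₖ-block _ _ hub~leaf          = refl
  ~ₖ-block _ _ leaf~hub          = refl

  centre? : (x : Kind r s m) → Dec (x ≡ centre)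
  centre? centre     = yes refl
  centre? (hub _ _)  = no λ ()
  centre? (leaf _ _) = no λ ()

  hub≢centre : ∀ {x : Kind r s m} {b a} → x ≡ hub b a → x ≢ centre
  hub≢centre refl ()

  hub-slot : ∀ {x y} → x ~ₖ y → Fin s ⊎ Fin s
  hub-slot (centre~hub {a = a}) = inj₂ a
  hub-slot (hub~centre {a = a}) = inj₁ a
  hub-slot (hub~hub {a = a} _)  = inj₁ a
  hub-slot (hub~leaf {a = a})   = inj₁ a
  hub-slot (leaf~hub {a = a})   = inj₂ a

  hub-slot-inj₁ : ∀ {x y a} (e : x ~ₖ y) → hub-slot e ≡ inj₁ a → ∃ λ b → x ≡ hub b a
  hub-slot-inj₁ centre~hub  ()
  hub-slot-inj₁ hub~centre  refl = _ , refl
  hub-slot-inj₁ (hub~hub _) refl = _ , refl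
  hub-slot-inj₁ hub~leaf    refl = _ , refl
  hub-slot-inj₁ leaf~hub    ()

  hub-slot-inj₂ : ∀ {x y a} (e : x ~ₖ y) → hub-slot e ≡ inj₂ a → ∃ λ b → y ≡ hub b a
  hub-slot-inj₂ centre~hub  refl = _ , refl
  hub-slot-inj₂ hub~centre  ()
  hub-slot-inj₂ (hub~hub _) ()
  hub-slot-inj₂ hub~leaf    ()
  hub-slot-inj₂ leaf~hub    refl = _ , refl

  module OnCycle {p} (C : Cycle _~_ p) where
    open Cycle C

    component : Fin (ℕ.suc p) → Fin t
    component = proj₁ ∘ vertex

    kind : Fin (ℕ.suc p) → Kind r s m
    kind = proj₂ ∘ vertex

    kind-injective : Injective _≡_ _≡_ kind
    kind-injective {x} {y} e = injective (cong₂ _,_ component-constant e)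
      where
      component-constant : component x ≡ component y
      component-constant = trans (steps-preserve⇒constant component (proj₁ ∘ step) x)
                                 (sym (steps-preserve⇒constant component (proj₁ ∘ step) y))

    -- The centre occurs at most once, and the rest of the cycle is a path avoiding it.
    block-constant : ∀ {x y} → kind x ≢ centre → kind y ≢ centre → block (kind x) ≡ block (kind y)
    block-constant {x} {y} x≢centre y≢centre with any? (centre? ∘ kind)
    ... | yes (q , q-centre) =
      steps-preserve-except⇒constant (block ∘ kind) q
        (λ i i≢q 1+i≢q → ~ₖ-block (off-centre i≢q) (off-centre 1+i≢q) (proj₂ (step i)))
        (λ last≢q 0≢q → ~ₖ-block (off-centre last≢q) (off-centre 0≢q) (proj₂ close))
        (λ x≡q → x≢centre (trans (cong kind x≡q) q-centre))
        (λ y≡q → y≢centre (trans (cong kind y≡q) q-centre))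
      where
      off-centre : ∀ {z} → z ≢ q → kind z ≢ centre
      off-centre z≢q z-centre = z≢q (kind-injective (trans z-centre (sym q-centre)))
    ... | no no-centre = trans (to-zero x) (sym (to-zero y))
      where
      to-zero : ∀ z → block (kind z) ≡ block (kind zero)
      to-zero = steps-preserve⇒constant (block ∘ kind)
        (λ i → ~ₖ-block (λ c → no-centre (_ , c)) (λ c → no-centre (_ , c)) (proj₂ (step i)))

    hub-injective : ∀ {x y b b' a} → kind x ≡ hub b a → kind y ≡ hub b' a → x ≡ y
    hub-injective {x} {y} {b} {b'} {a} x-hub y-hub = kind-injective (begin
      kind x   ≡⟨ x-hub ⟩
      hub b a  ≡⟨ cong (λ β → hub β a) (just-injective same-block) ⟩
      hub b' a ≡⟨ y-hub ⟨
      kind y   ∎)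
      where
      open ≡-Reasoning
      same-block : just b ≡ just b'
      same-block = subst₂ (λ u v → block u ≡ block v) x-hub y-hub
                     (block-constant (hub≢centre x-hub) (hub≢centre y-hub))

    -- The centre and the leaves are tagged with the slot of the hub following them; since all
    -- hubs of the cycle lie in one block, the tag determines the position.
    slot-code : Fin (ℕ.suc p) → Fin s ⊎ Fin s
    slot-code x = hub-slot (proj₂ (step-next x))

    slot-code-injective : Injective _≡_ _≡_ slot-code
    slot-code-injective {x} {y} e with slot-code x in x-code
    ... | inj₁ _ = hub-injective (proj₂ (hub-slot-inj₁ _ x-code)) (proj₂ (hub-slot-inj₁ _ (sym e)))
    ... | inj₂ _ = next-injective
      (hub-injective (proj₂ (hub-slot-inj₂ _ x-code)) (proj₂ (hub-slot-inj₂ _ (sym e))))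

    length-≤ : ℕ.suc p ≤ s ℕ.+ s
    length-≤ = injective⇒≤ {f = join s s ∘ slot-code} (slot-code-injective ∘ ↔-from-injective +↔⊎)

  no-long-cycle : ∀ {k} → s ℕ.+ s ≤ k → ¬ HasCycleAtLeast graph (ℕ.suc k)
  no-long-cycle = cycles-bounded⇒no-long-cycle OnCycle.length-≤

0<1/n : ∀ n → 0ℚ ℚ.< + 1 ℚ./ ℕ.suc n
0<1/n n = toℚᵘ-cancel-< (ℚᵘ.<-respʳ-≃ (ℚᵘ.≃-sym (toℚᵘ-fromℚᵘ (mkℚᵘ (+ 1) n))) (ℚᵘ.*<* (+<+ (ℕ.s≤s ℕ.z≤n))))

cross-multiply : ∀ a M X e θ → (a ℕ.* ℕ.suc M ℕ.+ 1) ℕ.* X < θ ℕ.* (ℕ.suc M ℕ.* ℕ.suc e) →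
  (natℚ a ℚ.+ + 1 ℚ./ ℕ.suc M) ℚ.* ratio X (ℕ.suc e) ℚ.< natℚ θ
cross-multiply a M X e θ h =
  toℚᵘ-cancel-< (ℚᵘ.<-respˡ-≃ (ℚᵘ.≃-sym lhs≃) (ℚᵘ.<-respʳ-≃ (ℚᵘ.≃-sym (toℚᵘ-fromℚᵘ θ/1)) unnormalised))
  where
  a/1 θ/1 1/M X/e : ℚᵘ
  a/1 = mkℚᵘ (+ a) 0
  θ/1 = mkℚᵘ (+ θ) 0
  1/M = mkℚᵘ (+ 1) M
  X/e = mkℚᵘ (+ X) e

  lhs≃ : toℚᵘ ((natℚ a ℚ.+ + 1 ℚ./ ℕ.suc M) ℚ.* ratio X (ℕ.suc e)) ℚᵘ.≃ (a/1 ℚᵘ.+ 1/M) ℚᵘ.* X/e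
  lhs≃ = ℚᵘ.≃-trans (toℚᵘ-homo-* (natℚ a ℚ.+ + 1 ℚ./ ℕ.suc M) (ratio X (ℕ.suc e)))
           (ℚᵘ.*-cong (ℚᵘ.≃-trans (toℚᵘ-homo-+ (natℚ a) (+ 1 ℚ./ ℕ.suc M))
                                  (ℚᵘ.+-cong (toℚᵘ-fromℚᵘ a/1) (toℚᵘ-fromℚᵘ 1/M)))
                      (toℚᵘ-fromℚᵘ X/e))

  numerator : + ((a ℕ.* ℕ.suc M ℕ.+ 1) ℕ.* X) ≡ ((+ a ℤ.* + ℕ.suc M ℤ.+ + 1) ℤ.* + X) ℤ.* + 1
  numerator = begin
    + ((a ℕ.* ℕ.suc M ℕ.+ 1) ℕ.* X)       ≡⟨ ℤ.pos-* (a ℕ.* ℕ.suc M ℕ.+ 1) X ⟩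
    + (a ℕ.* ℕ.suc M ℕ.+ 1) ℤ.* + X       ≡⟨ cong (ℤ._* + X) (ℤ.pos-+ (a ℕ.* ℕ.suc M) 1) ⟩
    (+ (a ℕ.* ℕ.suc M) ℤ.+ + 1) ℤ.* + X   ≡⟨ cong (λ z → (z ℤ.+ + 1) ℤ.* + X) (ℤ.pos-* a (ℕ.suc M)) ⟩
    (+ a ℤ.* + ℕ.suc M ℤ.+ + 1) ℤ.* + X   ≡⟨ ℤ.*-identityʳ _ ⟨
    ((+ a ℤ.* + ℕ.suc M ℤ.+ + 1) ℤ.* + X) ℤ.* + 1 ∎
    where open ≡-Reasoning

  denominator : + (θ ℕ.* (ℕ.suc M ℕ.* ℕ.suc e)) ≡ + θ ℤ.* + ((1 ℕ.* ℕ.suc M) ℕ.* ℕ.suc e)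
  denominator = trans (ℤ.pos-* θ _) (cong (λ z → + θ ℤ.* + (z ℕ.* ℕ.suc e)) (sym (ℕ.*-identityˡ (ℕ.suc M))))

  unnormalised : (a/1 ℚᵘ.+ 1/M) ℚᵘ.* X/e ℚᵘ.< θ/1
  unnormalised = ℚᵘ.*<* (subst₂ ℤ._<_ numerator denominator (+<+ h))

-- A component has M = 1 + r d vertices, where d = r s; the left side is s M + 1 = s + 1 + d².
component-size-bound : ∀ r' s → 1 ≤ r' → 1 ≤ s →
  let r = ℕ.suc r' ; d = r ℕ.* s in s ℕ.* ℕ.suc (r ℕ.* s ℕ.+ r ℕ.* (r' ℕ.* s)) ℕ.+ 1 ≤ ℕ.suc d ℕ.* d
component-size-bound r' s 1≤r' 1≤s = begin
  s ℕ.* ℕ.suc (r ℕ.* s ℕ.+ r ℕ.* (r' ℕ.* s)) ℕ.+ 1 ≡⟨ expand r' s ⟩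
  s ℕ.+ 1 ℕ.+ d ℕ.* d                             ≤⟨ ℕ.+-monoˡ-≤ (d ℕ.* d) (ℕ.+-monoʳ-≤ s (ℕ.*-mono-≤ 1≤r' 1≤s)) ⟩
  ℕ.suc d ℕ.* d                                    ∎
  where
  open ℕ.≤-Reasoning
  r d : ℕ
  r = ℕ.suc r'
  d = r ℕ.* s
  expand : ∀ r' s → s ℕ.* ℕ.suc (ℕ.suc r' ℕ.* s ℕ.+ ℕ.suc r' ℕ.* (r' ℕ.* s)) ℕ.+ 1
                    ≡ s ℕ.+ 1 ℕ.+ (ℕ.suc r' ℕ.* s) ℕ.* (ℕ.suc r' ℕ.* s)
  expand = solve-∀

cross-multiplied-bound : ∀ {A X t M d θ} → 0 < A → A ≤ ℕ.suc d ℕ.* d → ℕ.suc X ≡ t ℕ.* M →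
  t ℕ.* ℕ.suc d < θ → A ℕ.* X < θ ℕ.* (M ℕ.* d)
cross-multiplied-bound {A} {X} {t} {M} {d} {θ} 0<A A≤[d+1]d 1+X≡tM t[d+1]<θ = begin-strict
  A ℕ.* X                      <⟨ ℕ.m<m+n (A ℕ.* X) 0<A ⟩
  A ℕ.* X ℕ.+ A                ≡⟨ ℕ.+-comm (A ℕ.* X) A ⟩
  A ℕ.+ A ℕ.* X                ≡⟨ ℕ.*-suc A X ⟨
  A ℕ.* ℕ.suc X                ≡⟨ cong (A ℕ.*_) 1+X≡tM ⟩
  A ℕ.* (t ℕ.* M)              ≤⟨ ℕ.*-monoˡ-≤ (t ℕ.* M) A≤[d+1]d ⟩
  ℕ.suc d ℕ.* d ℕ.* (t ℕ.* M)  ≡⟨ regroup (ℕ.suc d) d t M ⟩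
  t ℕ.* ℕ.suc d ℕ.* (M ℕ.* d)  ≤⟨ ℕ.*-monoˡ-≤ (M ℕ.* d) (ℕ.<⇒≤ t[d+1]<θ) ⟩
  θ ℕ.* (M ℕ.* d)              ∎
  where
  open ℕ.≤-Reasoning
  regroup : ∀ a d t M → a ℕ.* d ℕ.* (t ℕ.* M) ≡ t ℕ.* a ℕ.* (M ℕ.* d)
  regroup = solve-∀

θ-lower-bound : ∀ {k} s → 1 ≤ s → s ℕ.+ s ≤ k → (D : ℕ) →
  ∃ λ d → D < d × k ≤ d × ∃ λ (c : ℚ) → 0ℚ ℚ.< c ×
    ((N : ℕ) → ∃ λ n → N < n × d < n ×
      ((θ : ℕ) → IsTheta n d k θ → (natℚ s ℚ.+ c) ℚ.* ratio (n ℕ.∸ 1) d ℚ.< natℚ θ))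
θ-lower-bound {k} s@(ℕ.suc _) 1≤s 2s≤k D = d , D<d , k≤d , + 1 ℚ./ M , 0<1/n M' , λ N →
  ℕ.suc N ℕ.* M , N<n N , d<n N , λ θ θ-is-theta →
    cross-multiply s M' (ℕ.suc N ℕ.* M ℕ.∸ 1) (ℕ.pred d) θ
      (cross-multiplied-bound {t = ℕ.suc N} {d = d} (ℕ.m≤n+m 1 (s ℕ.* M))
        (component-size-bound r' s (ℕ.s≤s ℕ.z≤n) 1≤s) refl (many-high-degree<θ N θ-is-theta))
  where
  r' r m d M' M : ℕ
  r' = ℕ.suc (D ℕ.+ k)
  r  = ℕ.suc r'
  m  = r' ℕ.* s
  d  = r ℕ.* s
  M' = r ℕ.* s ℕ.+ r ℕ.* m
  M  = ℕ.suc M'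

  D+k<d : D ℕ.+ k < d
  D+k<d = ℕ.≤-trans (ℕ.n≤1+n r') (ℕ.m≤m*n r s)

  D<d : D < d
  D<d = ℕ.≤-<-trans (ℕ.m≤m+n D k) D+k<d

  k≤d : k ≤ d
  k≤d = ℕ.<⇒≤ (ℕ.≤-<-trans (ℕ.m≤n+m k D) D+k<d)

  N<n : ∀ N → N < ℕ.suc N ℕ.* M
  N<n N = ℕ.<-≤-trans (ℕ.n<1+n N) (ℕ.m≤m*n (ℕ.suc N) M)

  d<n : ∀ N → d < ℕ.suc N ℕ.* M
  d<n N = ℕ.<-≤-trans (ℕ.s≤s (ℕ.m≤m+n d (r ℕ.* m))) (ℕ.m≤n*m M (ℕ.suc N))

  many-high-degree<θ : ∀ N {θ} → IsTheta (ℕ.suc N ℕ.* M) d k θ → ℕ.suc N ℕ.* ℕ.suc d < θ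
  many-high-degree<θ N θ-is-theta =
    ℕ.≤-<-trans (high-degree-count ℕ.≤-refl ℕ.≤-refl)
                (numHighDeg<θ {d = d} graph (no-long-cycle 2s≤k) θ-is-theta)
    where open Construction (ℕ.suc N) r s m

proposition5p1 : (k : ℕ) → 2 ≤ k →
    (D : ℕ) → ∃ λ d → D < d × k ≤ d ×
      ∃ λ (c : ℚ) → ℚ._<_ 0ℚ c ×
        ((N : ℕ) → ∃ λ n → N < n × d < n ×
          ((θ : ℕ) → IsTheta n d k θ →
            ℚ._<_ ((natℚ (k / 2) + c) * ratio (n ∸ 1) d) (natℚ θ)))
proposition5p1 k 2≤k = θ-lower-bound (k / 2) (m≥n⇒m/n>0 2≤k) half+half≤k
  where
  half+half≤k : k / 2 ℕ.+ k / 2 ≤ k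
  half+half≤k = ℕ.≤-trans (ℕ.≤-reflexive (double≡*2 (k / 2))) (m/n*n≤m k 2)
    where
    double≡*2 : ∀ q → q ℕ.+ q ≡ q ℕ.* 2
    double≡*2 = solve-∀
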